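{- Every digraph that has sign symmetric $P_0^+$-completion also has sign symmetric $P_{0,1}$-completion.
   Context: For a real $n\times n$ matrix: a $P_0$-matrix has all principal minors nonnegative; a $P_{0,1}$-matrix is a $P_0$-matrix with all diagonal entries positive; a $P_0^+$-matrix is one where for every $k\in\{1,\dots,n\}$ all $k\times k$ principal minors are nonnegative and at least one is positive. A matrix is sign symmetric if for all $i\neq j$ either $a_{ij}a_{ji}>0$ or $a_{ij}=a_{ji}=0$ (twin entries). A partial matrix has some entries specified (real numbers) and others unspecified; a completion assigns real values to the unspecified entries; a principal submatrix is fully specified if all its entries are specified. A partial sign symmetric $P_{0,1}$-matrix is a partial matrix whose specified diagonal entries are positive, whose fully specified principal minors are nonnegative, and whose pairs of fully specified twin entries have positive product or are both zero. A partial sign symmetric $P_0^+$-matrix is a partial matrix whose fully specified principal minors are nonnegative and whose pairs of fully specified twin entries have positive product or are both zero, and which, if all its entries are specified, is a sign symmetric $P_0^+$-matrix. A partial $n\times n$ matrix specifies a digraph $D$ on $\{1,\dots,n\}$ (loops allowed) if entry $(i,j)$ (including $i=j$) is specified iff $(i,j)$ is an arc of $D$. For a class $\mathcal{X}$, a digraph $D$ has sign symmetric $\mathcal{X}$-completion if every partial sign symmetric $\mathcal{X}$-matrix specifying $D$ has a completion which is a sign symmetric $\mathcal{X}$-matrix. -}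

module Defs where

open import Level using (0ℓ)
open import Data.Nat using (ℕ; zero; suc)
import Data.Nat as ℕ
open import Data.Fin using (Fin; zero; suc; punchIn) renaming (_<_ to _<ᶠ_)
open import Data.Bool using (Bool; true; false)
open import Data.Maybe using (Maybe; just; nothing; is-just)
open import Data.Product using (Σ; ∃; ∃-syntax; _×_; _,_)
open import Data.Sum using (_⊎_)
open import Relation.Binary.PropositionalEquality using (_≡_; _≢_)
open import Relation.Binary.Structures using (IsTotalOrder)
open import Algebra.Structures using (IsCommutativeRing)

-- The real numbers, given axiomatically as a complete ordered field
-- (unique up to isomorphism), with propositional equality.

record CompleteOrderedField : Set₁ where
  infixl 6 _+_
  infixl 7 _*_
  infix 4 _≤_ _<_
  field
    Carrier : Set
    _+_ _*_ : Carrier → Carrier → Carrier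
    -_ : Carrier → Carrier
    0# 1# : Carrier
    _≤_ : Carrier → Carrier → Set
    isCommutativeRing : IsCommutativeRing _≡_ _+_ _*_ -_ 0# 1#
    0≢1 : 0# ≢ 1#
    inverse : ∀ x → x ≢ 0# → ∃[ y ] (x * y ≡ 1#)
    isTotalOrder : IsTotalOrder _≡_ _≤_
    +-mono-≤ : ∀ {x y} z → x ≤ y → x + z ≤ y + z
    *-nonneg : ∀ {x y} → 0# ≤ x → 0# ≤ y → 0# ≤ x * y
    sup : (S : Carrier → Set) → ∃[ x ] S x → ∃[ b ] (∀ x → S x → x ≤ b) →
          ∃[ s ] ((∀ x → S x → x ≤ s) × (∀ b → (∀ x → S x → x ≤ b) → s ≤ b))

  _<_ : Carrier → Carrier → Set
  x < y = (x ≤ y) × (x ≢ y)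

module Matrices (ℝ : CompleteOrderedField) where
  open CompleteOrderedField ℝ renaming (Carrier to R)

  Matrix : ℕ → Set
  Matrix n = Fin n → Fin n → R

  Σᶠ : ∀ {m} → (Fin m → R) → R
  Σᶠ {zero} f = 0#
  Σᶠ {suc m} f = f zero + Σᶠ (λ i → f (suc i))

  alt : ∀ {m} → Fin m → R → R
  alt zero x = x
  alt (suc j) x = - alt j x

  det : ∀ {n} → Matrix n → R
  det {zero} M = 1#
  det {suc n} M = Σᶠ (λ j → alt j (M zero j * det (λ r c → M (suc r) (punchIn j c))))

  StrictlyIncreasing : ∀ {k n} → (Fin k → Fin n) → Set
  StrictlyIncreasing σ = ∀ i j → i <ᶠ j → σ i <ᶠ σ j

  principalSub : ∀ {k n} → Matrix n → (Fin k → Fin n) → Matrix k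
  principalSub M σ i j = M (σ i) (σ j)

  IsSignSymmetric : ∀ {n} → Matrix n → Set
  IsSignSymmetric {n} M = ∀ (i j : Fin n) → i ≢ j →
    (0# < M i j * M j i) ⊎ (M i j ≡ 0# × M j i ≡ 0#)

  IsP₀ : ∀ {n} → Matrix n → Set
  IsP₀ {n} M = ∀ k (σ : Fin (suc k) → Fin n) → StrictlyIncreasing σ →
    0# ≤ det (principalSub M σ)

  IsP₀₁ : ∀ {n} → Matrix n → Set
  IsP₀₁ {n} M = IsP₀ M × (∀ (i : Fin n) → 0# < M i i)

  IsP₀⁺ : ∀ {n} → Matrix n → Set
  IsP₀⁺ {n} M = ∀ k → suc k ℕ.≤ n →
    (∀ (τ : Fin (suc k) → Fin n) → StrictlyIncreasing τ → 0# ≤ det (principalSub M τ))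
    × (Σ (Fin (suc k) → Fin n) λ τ → (StrictlyIncreasing τ × (0# < det (principalSub M τ))))

  -- digraph on {1..n} (loops allowed): arc relation
  Digraph : ℕ → Set
  Digraph n = Fin n → Fin n → Bool

  PartialMatrix : ℕ → Set
  PartialMatrix n = Fin n → Fin n → Maybe R

  Specifies : ∀ {n} → PartialMatrix n → Digraph n → Set
  Specifies A D = ∀ i j → is-just (A i j) ≡ D i j

  IsCompletion : ∀ {n} → PartialMatrix n → Matrix n → Set
  IsCompletion A B = ∀ i j x → A i j ≡ just x → B i j ≡ x

  FullySpecified : ∀ {n} → PartialMatrix n → Matrix n → Set
  FullySpecified A M = ∀ i j → A i j ≡ just (M i j)

  PartialMinorsNonneg : ∀ {n} → PartialMatrix n → Set
  PartialMinorsNonneg {n} A = ∀ k (σ : Fin (suc k) → Fin n) → StrictlyIncreasing σ →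
    ∀ (M : Matrix (suc k)) → (∀ i j → A (σ i) (σ j) ≡ just (M i j)) → 0# ≤ det M

  PartialSignSymmetric : ∀ {n} → PartialMatrix n → Set
  PartialSignSymmetric {n} A = ∀ (i j : Fin n) → i ≢ j → ∀ x y →
    A i j ≡ just x → A j i ≡ just y → (0# < x * y) ⊎ (x ≡ 0# × y ≡ 0#)

  IsPartialSSP₀₁ : ∀ {n} → PartialMatrix n → Set
  IsPartialSSP₀₁ {n} A = (∀ (i : Fin n) x → A i i ≡ just x → 0# < x)
    × PartialMinorsNonneg A × PartialSignSymmetric A

  IsPartialSSP₀⁺ : ∀ {n} → PartialMatrix n → Set
  IsPartialSSP₀⁺ {n} A = PartialMinorsNonneg A × PartialSignSymmetric A
    × (∀ M → FullySpecified A M → IsSignSymmetric M × IsP₀⁺ M)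

  HasSSP₀₁Completion : ∀ {n} → Digraph n → Set
  HasSSP₀₁Completion {n} D = ∀ (A : PartialMatrix n) → Specifies A D → IsPartialSSP₀₁ A →
    ∃[ B ] (IsCompletion A B × IsSignSymmetric B × IsP₀₁ B)

  HasSSP₀⁺Completion : ∀ {n} → Digraph n → Set
  HasSSP₀⁺Completion {n} D = ∀ (A : PartialMatrix n) → Specifies A D → IsPartialSSP₀⁺ A →
    ∃[ B ] (IsCompletion A B × IsSignSymmetric B × IsP₀⁺ B)

{-# OPTIONS --safe #-}

-- If every entry is specified, a partial sign symmetric P₀,₁-matrix is its own completion (it need not be
-- P₀⁺, which is why this case is separate). Otherwise the P₀⁺ requirement on fully specified matrices is
-- vacuous, so there is a sign symmetric P₀⁺-completion B, which in particular is P₀. Adding 1 to every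
-- unspecified diagonal entry of B makes the diagonal positive and keeps B sign symmetric and P₀: raising
-- entry (r, s) of a matrix by t raises its determinant by t times the (r, s) cofactor, so raising a diagonal
-- entry of a principal submatrix adds t times a complementary principal minor.

module Submission where

open import Defs
open import Data.Nat using (ℕ; zero; suc)

open import Level using (0ℓ)
open import Algebra.Bundles using (CommutativeRing)
open import Data.Fin using (Fin; zero; suc; punchIn; punchOut)
open import Data.Fin.Properties
  using (_≟_; <-cmp; <⇒≢; ≤∧≢⇒<; any?; all?; injective⇒≤; suc-injective;
         punchInᵢ≢i; punchIn-injective; punchIn-mono-≤; punchIn-punchOut)
open import Data.List using (List; []; _∷_; allFin)
open import Data.List.Membership.Propositional using (_∉_)
open import Data.List.Membership.Propositional.Properties using (∈-allFin)
open import Data.List.Relation.Unary.Any using (here; there)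
open import Data.Maybe using (Maybe; just; nothing)
open import Data.Maybe.Properties using (just-injective)
open import Data.Nat.Properties using (<⇒≤)
open import Data.Product using (∃-syntax; _×_; _,_; proj₁; proj₂)
open import Data.Sum using (_⊎_; inj₁; inj₂)
open import Data.Vec.Functional using (updateAt)
open import Data.Vec.Functional.Properties using (updateAt-updates; updateAt-minimal)
open import Function using (_∘_; const; case_of_)
open import Function.Definitions using (Injective)
open import Relation.Binary.Definitions using (tri<; tri≈; tri>)
open import Relation.Binary.PropositionalEquality
open import Relation.Binary.Structures using (IsTotalOrder)
open import Relation.Nullary using (¬_; Dec; yes; no; contradiction)
open import Relation.Nullary.Decidable using (map′)

module SignSymmetricCompletion (ℝ : CompleteOrderedField) where
  open CompleteOrderedField ℝ renaming (Carrier to R)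
  open Matrices ℝ

  commutativeRing : CommutativeRing 0ℓ 0ℓ
  commutativeRing = record { isCommutativeRing = isCommutativeRing }

  open CommutativeRing commutativeRing
    using (+-assoc; +-comm; distribˡ; distribʳ; +-identityˡ; +-identityʳ; *-identityˡ; *-identityʳ; zeroʳ;
           -‿inverseʳ; ring; +-commutativeSemigroup; *-commutativeSemigroup)
  open import Algebra.Properties.Ring ring
    using (-‿involutive; -‿distribˡ-*; -‿distribʳ-*; -0#≈0#; -‿+-comm)
  open import Algebra.Properties.CommutativeSemigroup +-commutativeSemigroup
    using (xy∙z≈xz∙y; x∙yz≈y∙xz; interchange)
  open import Algebra.Properties.CommutativeSemigroup *-commutativeSemigroup
    using () renaming (x∙yz≈y∙xz to *-leftSwap)
  open IsTotalOrder isTotalOrder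
    using () renaming (trans to ≤-trans; antisym to ≤-antisym; total to ≤-total; reflexive to ≤-reflexive)
  open ≡-Reasoning

  0≤1 : 0# ≤ 1#
  0≤1 with ≤-total 0# 1#
  ... | inj₁ 0≤1 = 0≤1
  ... | inj₂ 1≤0 = subst (0# ≤_) -1²≡1 (*-nonneg 0≤-1 0≤-1)
    where
    0≤-1 : 0# ≤ - 1#
    0≤-1 = subst₂ _≤_ (-‿inverseʳ 1#) (+-identityˡ (- 1#)) (+-mono-≤ (- 1#) 1≤0)
    -1²≡1 : - 1# * - 1# ≡ 1#
    -1²≡1 = trans (sym (-‿distribˡ-* 1# (- 1#))) (trans (cong -_ (*-identityˡ (- 1#))) (-‿involutive 1#))

  x≤y⇒0≤y-x : ∀ {x y} → x ≤ y → 0# ≤ y + - x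
  x≤y⇒0≤y-x {x} x≤y = subst (_≤ _) (-‿inverseʳ x) (+-mono-≤ (- x) x≤y)

  x+[y-x]≡y : ∀ x y → x + (y + - x) ≡ y
  x+[y-x]≡y x y = trans (x∙yz≈y∙xz x y (- x)) (trans (cong (y +_) (-‿inverseʳ x)) (+-identityʳ y))

  x≤x+t : ∀ {x t} → 0# ≤ t → x ≤ x + t
  x≤x+t {x} {t} 0≤t = subst₂ _≤_ (+-identityˡ x) (+-comm t x) (+-mono-≤ x 0≤t)

  +-nonneg : ∀ {x y} → 0# ≤ x → 0# ≤ y → 0# ≤ x + y
  +-nonneg {x} {y} 0≤x 0≤y = ≤-trans (subst (0# ≤_) (sym (+-identityˡ y)) 0≤y) (+-mono-≤ y 0≤x)

  0≤x⇒0<x+1 : ∀ {x} → 0# ≤ x → 0# < x + 1#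
  0≤x⇒0<x+1 {x} 0≤x = +-nonneg 0≤x 0≤1 , λ 0≡x+1 → 0≢1 (≤-antisym 0≤1 (subst (1# ≤_) (sym 0≡x+1) 1≤x+1))
    where
    1≤x+1 : 1# ≤ x + 1#
    1≤x+1 = subst (1# ≤_) (+-comm 1# x) (x≤x+t 0≤x)

  alt-distrib-+ : ∀ {m} (j : Fin m) x y → alt j (x + y) ≡ alt j x + alt j y
  alt-distrib-+ zero    x y = refl
  alt-distrib-+ (suc j) x y = trans (cong -_ (alt-distrib-+ j x y)) (sym (-‿+-comm (alt j x) (alt j y)))

  alt-*ˡ : ∀ {m} (j : Fin m) t x → alt j (t * x) ≡ t * alt j x
  alt-*ˡ zero    t x = refl
  alt-*ˡ (suc j) t x = trans (cong -_ (alt-*ˡ j t x)) (-‿distribʳ-* t (alt j x))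

  alt-0# : ∀ {m} (j : Fin m) → alt j 0# ≡ 0#
  alt-0# zero    = refl
  alt-0# (suc j) = trans (cong -_ (alt-0# j)) -0#≈0#

  alt-neg : ∀ {m} (j : Fin m) x → alt j (- x) ≡ - alt j x
  alt-neg zero    x = refl
  alt-neg (suc j) x = cong -_ (alt-neg j x)

  alt-involutive : ∀ {m} (j : Fin m) x → alt j (alt j x) ≡ x
  alt-involutive zero    x = refl
  alt-involutive (suc j) x = trans (cong -_ (alt-neg j (alt j x))) (trans (-‿involutive _) (alt-involutive j x))

  alt-comm : ∀ {m k} (i : Fin m) (j : Fin k) x → alt i (alt j x) ≡ alt j (alt i x)
  alt-comm zero    j x = refl
  alt-comm (suc i) j x = trans (cong -_ (alt-comm i j x)) (sym (alt-neg j (alt i x)))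

  alt-punchIn-punchOut : ∀ {n} (s : Fin (suc n)) (j : Fin n) (p : punchIn s j ≢ s) x →
                         alt (punchIn s j) (alt (punchOut p) x) ≡ - alt s (alt j x)
  alt-punchIn-punchOut zero    zero    p x = refl
  alt-punchIn-punchOut zero    (suc j) p x = refl
  alt-punchIn-punchOut (suc s) zero    p x = sym (-‿involutive _)
  alt-punchIn-punchOut (suc s) (suc j) p x = begin
    - alt (punchIn s j) (- alt (punchOut (p ∘ cong suc)) x) ≡⟨ cong -_ (alt-neg (punchIn s j) _) ⟩
    - - alt (punchIn s j) (alt (punchOut (p ∘ cong suc)) x) ≡⟨ cong (-_ ∘ -_) (alt-punchIn-punchOut s j (p ∘ cong suc) x) ⟩
    - - - alt s (alt j x)                                   ≡⟨ cong (-_ ∘ -_) (alt-neg s (alt j x)) ⟨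
    - - alt s (- alt j x)                                   ∎

  alt-nested-cofactor : ∀ {n k} (s : Fin (suc n)) (j : Fin n) (p : punchIn s j ≢ s) (r : Fin k) m y →
    alt (punchIn s j) (m * alt r (alt (punchOut p) y)) ≡ alt (suc r) (alt s (alt j (m * y)))
  alt-nested-cofactor s j p r m y = begin
    alt (punchIn s j) (m * alt r (alt (punchOut p) y))
      ≡⟨ cong (alt (punchIn s j)) (trans (cong (alt r) (alt-*ˡ (punchOut p) m y)) (alt-*ˡ r m _)) ⟨
    alt (punchIn s j) (alt r (alt (punchOut p) (m * y)))  ≡⟨ alt-comm (punchIn s j) r _ ⟩
    alt r (alt (punchIn s j) (alt (punchOut p) (m * y)))  ≡⟨ cong (alt r) (alt-punchIn-punchOut s j p _) ⟩
    alt r (- alt s (alt j (m * y)))                       ≡⟨ alt-neg r _ ⟩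
    alt (suc r) (alt s (alt j (m * y)))                   ∎

  Σᶠ-cong : ∀ {m} {f g : Fin m → R} → (∀ i → f i ≡ g i) → Σᶠ f ≡ Σᶠ g
  Σᶠ-cong {zero}  f≗g = refl
  Σᶠ-cong {suc m} f≗g = cong₂ _+_ (f≗g zero) (Σᶠ-cong (f≗g ∘ suc))

  Σᶠ-distrib-+ : ∀ {m} (f g : Fin m → R) → Σᶠ (λ i → f i + g i) ≡ Σᶠ f + Σᶠ g
  Σᶠ-distrib-+ {zero}  f g = sym (+-identityˡ 0#)
  Σᶠ-distrib-+ {suc m} f g = trans (cong (f zero + g zero +_) (Σᶠ-distrib-+ (f ∘ suc) (g ∘ suc))) (interchange _ _ _ _)

  *-distribˡ-Σᶠ : ∀ {m} t (f : Fin m → R) → t * Σᶠ f ≡ Σᶠ (λ i → t * f i)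
  *-distribˡ-Σᶠ {zero}  t f = zeroʳ t
  *-distribˡ-Σᶠ {suc m} t f = trans (distribˡ t _ _) (cong (t * f zero +_) (*-distribˡ-Σᶠ t (f ∘ suc)))

  alt-distrib-Σᶠ : ∀ {m k} (i : Fin k) (f : Fin m → R) → alt i (Σᶠ f) ≡ Σᶠ (λ j → alt i (f j))
  alt-distrib-Σᶠ {zero}  i f = alt-0# i
  alt-distrib-Σᶠ {suc m} i f = trans (alt-distrib-+ i _ _) (cong (alt i (f zero) +_) (alt-distrib-Σᶠ i (f ∘ suc)))

  Σᶠ-punchIn : ∀ {m} (f : Fin (suc m) → R) s → Σᶠ f ≡ f s + Σᶠ (f ∘ punchIn s)
  Σᶠ-punchIn f zero = refl
  Σᶠ-punchIn {suc m} f (suc s) = trans (cong (f zero +_) (Σᶠ-punchIn (f ∘ suc) s)) (x∙yz≈y∙xz _ _ _)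

  det-cong : ∀ {n} {M N : Matrix n} → (∀ i j → M i j ≡ N i j) → det M ≡ det N
  det-cong {zero}  M≗N = refl
  det-cong {suc n} M≗N = Σᶠ-cong λ j →
    cong₂ (λ a d → alt j (a * d)) (M≗N zero j) (det-cong λ r c → M≗N (suc r) (punchIn j c))

  deleteRowCol : ∀ {n} → Fin (suc n) → Fin (suc n) → Matrix (suc n) → Matrix n
  deleteRowCol r s M i j = M (punchIn r i) (punchIn s j)

  cofactor : ∀ {n} → Fin (suc n) → Fin (suc n) → Matrix (suc n) → R
  cofactor r s M = alt r (alt s (det (deleteRowCol r s M)))

  record EntryIncrement {n} (M : Matrix n) (r s : Fin n) (t : R) (M' : Matrix n) : Set where
    field
      other-rows : ∀ i j → i ≢ r → M' i j ≡ M i j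
      same-row   : ∀ j → j ≢ s → M' r j ≡ M r j
      entry      : M' r s ≡ M r s + t

    other-columns : ∀ i j → j ≢ s → M' i j ≡ M i j
    other-columns i j j≢s with i ≟ r
    ... | yes refl = same-row j j≢s
    ... | no i≢r   = other-rows i j i≢r

  punchIn-punchIn-punchOut : ∀ {n} (s : Fin (suc (suc n))) (j : Fin (suc n)) (p : punchIn s j ≢ s) (b : Fin n) →
                             punchIn (punchIn s j) (punchIn (punchOut p) b) ≡ punchIn s (punchIn j b)
  punchIn-punchIn-punchOut zero    j       p b       = refl
  punchIn-punchIn-punchOut (suc s) zero    p b       = refl
  punchIn-punchIn-punchOut (suc s) (suc j) p zero    = refl
  punchIn-punchIn-punchOut (suc s) (suc j) p (suc b) = cong suc (punchIn-punchIn-punchOut s j (p ∘ cong suc) b)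

  EntryIncrement-deleteFirstRow : ∀ {n} {M M' : Matrix (suc (suc n))} {r s t} →
    EntryIncrement M (suc r) s t M' → ∀ j (p : j ≢ s) →
    EntryIncrement (deleteRowCol zero j M) r (punchOut p) t (deleteRowCol zero j M')
  EntryIncrement-deleteFirstRow {M = M} {M'} {r} {s} {t} inc j p = record
    { other-rows = λ a c a≢r → other-rows (suc a) (punchIn j c) (a≢r ∘ suc-injective)
    ; same-row   = λ c c≢s′ → same-row (punchIn j c) λ e → c≢s′ (punchIn-injective j c _ (trans e (sym j→s)))
    ; entry      = subst (λ c → M' (suc r) c ≡ M (suc r) c + t) (sym j→s) entry
    }
    where
    open EntryIncrement inc
    j→s : punchIn j (punchOut p) ≡ s
    j→s = punchIn-punchOut p

  deleteRowCol-deleteRowCol : ∀ {n} (M : Matrix (suc (suc n))) r s j (p : punchIn s j ≢ s) →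
    ∀ a b → deleteRowCol r (punchOut p) (deleteRowCol zero (punchIn s j) M) a b
          ≡ deleteRowCol zero j (deleteRowCol (suc r) s M) a b
  deleteRowCol-deleteRowCol M r s j p a b = cong (M (suc (punchIn r a))) (punchIn-punchIn-punchOut s j p b)

  det-increment-firstRow : ∀ {n} {M M' : Matrix (suc n)} {s t} → EntryIncrement M zero s t M' →
                           det M' ≡ det M + t * cofactor zero s M
  det-increment-firstRow {n} {M} {M'} {s} {t} inc = begin
    det M'                                            ≡⟨ Σᶠ-cong (λ j → cong (alt j ∘ (M' zero j *_)) (minor-unchanged j)) ⟩
    Σᶠ (λ j → term j (M' zero j))                     ≡⟨ Σᶠ-punchIn (λ j → term j (M' zero j)) s ⟩
    term s (M' zero s) + Σᶠ (λ j → term (punchIn s j) (M' zero (punchIn s j)))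
      ≡⟨ cong₂ _+_ (cong (term s) entry) (Σᶠ-cong λ j → cong (term (punchIn s j)) (same-row _ (punchInᵢ≢i s j))) ⟩
    term s (M zero s + t) + Σᶠ (f ∘ punchIn s)        ≡⟨ cong (_+ Σᶠ (f ∘ punchIn s)) term-+ ⟩
    f s + t * cofactor zero s M + Σᶠ (f ∘ punchIn s)  ≡⟨ xy∙z≈xz∙y _ _ _ ⟩
    f s + Σᶠ (f ∘ punchIn s) + t * cofactor zero s M  ≡⟨ cong (_+ t * cofactor zero s M) (Σᶠ-punchIn f s) ⟨
    det M + t * cofactor zero s M                     ∎
    where
    open EntryIncrement inc
    term : Fin (suc n) → R → R
    term j x = alt j (x * det (deleteRowCol zero j M))
    f : Fin (suc n) → R
    f j = term j (M zero j)
    minor-unchanged : ∀ j → det (deleteRowCol zero j M') ≡ det (deleteRowCol zero j M)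
    minor-unchanged j = det-cong λ a b → other-rows (suc a) (punchIn j b) λ ()
    term-+ : term s (M zero s + t) ≡ f s + t * cofactor zero s M
    term-+ = trans (cong (alt s) (distribʳ _ (M zero s) t))
               (trans (alt-distrib-+ s _ _) (cong (f s +_) (alt-*ˡ s t _)))

  det-increment : ∀ {n} {M M' : Matrix (suc n)} {r s t} → EntryIncrement M r s t M' →
                  det M' ≡ det M + t * cofactor r s M
  det-increment {r = zero} = det-increment-firstRow
  -- Expand along the unchanged first row: the term for column s is unchanged, and each other term
  -- has a minor containing the incremented entry.
  det-increment {n = suc n} {M} {M'} {suc r} {s} {t} inc = begin
    det M'                                      ≡⟨ Σᶠ-cong (λ j → cong (term′ j) (other-rows zero j λ ())) ⟩
    Σᶠ g                                        ≡⟨ Σᶠ-punchIn g s ⟩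
    g s + Σᶠ (g ∘ punchIn s)                    ≡⟨ cong₂ _+_ g≡f-at-s (Σᶠ-cong g≡f+t*h) ⟩
    f s + Σᶠ (λ j → f (punchIn s j) + t * h j)  ≡⟨ cong (f s +_) (Σᶠ-distrib-+ (f ∘ punchIn s) (λ j → t * h j)) ⟩
    f s + (Σᶠ (f ∘ punchIn s) + Σᶠ (λ j → t * h j))
      ≡⟨ cong (λ x → f s + (Σᶠ (f ∘ punchIn s) + x)) (*-distribˡ-Σᶠ t h) ⟨
    f s + (Σᶠ (f ∘ punchIn s) + t * Σᶠ h)       ≡⟨ +-assoc _ _ _ ⟨
    f s + Σᶠ (f ∘ punchIn s) + t * Σᶠ h         ≡⟨ cong₂ (λ d c → d + t * c) (sym (Σᶠ-punchIn f s)) Σh≡cofactor ⟩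
    det M + t * cofactor (suc r) s M            ∎
    where
    open EntryIncrement inc
    term′ : Fin (suc (suc n)) → R → R
    term′ j a = alt j (a * det (deleteRowCol zero j M'))
    f g : Fin (suc (suc n)) → R
    f j = alt j (M zero j * det (deleteRowCol zero j M))
    g j = term′ j (M zero j)
    X : Matrix (suc n)
    X = deleteRowCol (suc r) s M
    v h : Fin (suc n) → R
    v j = alt j (X zero j * det (deleteRowCol zero j X))
    h j = alt (suc r) (alt s (v j))
    Σh≡cofactor : Σᶠ h ≡ cofactor (suc r) s M
    Σh≡cofactor = sym (trans (cong (alt (suc r)) (alt-distrib-Σᶠ s v)) (alt-distrib-Σᶠ (suc r) (alt s ∘ v)))
    g≡f-at-s : g s ≡ f s
    g≡f-at-s = cong (alt s ∘ (M zero s *_)) (det-cong λ a b → other-columns (suc a) (punchIn s b) (punchInᵢ≢i s b))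
    g≡f+t*h : ∀ j → g (punchIn s j) ≡ f (punchIn s j) + t * h j
    g≡f+t*h j = begin
      alt j′ (m * det (deleteRowCol zero j′ M'))  ≡⟨ cong (alt j′ ∘ (m *_)) (det-increment minor-increment) ⟩
      alt j′ (m * (d + t * c))                    ≡⟨ cong (alt j′) (distribˡ m d (t * c)) ⟩
      alt j′ (m * d + m * (t * c))                ≡⟨ cong (alt j′ ∘ (m * d +_)) (*-leftSwap m t c) ⟩
      alt j′ (m * d + t * (m * c))                ≡⟨ trans (alt-distrib-+ j′ _ _) (cong (f j′ +_) (alt-*ˡ j′ t _)) ⟩
      f j′ + t * alt j′ (m * c)                   ≡⟨ cong (λ x → f j′ + t * x) sign ⟩
      f j′ + t * h j                              ∎
      where
      j′ = punchIn s j
      p = punchInᵢ≢i s j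
      m = M zero j′
      d = det (deleteRowCol zero j′ M)
      minor-increment = EntryIncrement-deleteFirstRow inc j′ p
      c = cofactor r (punchOut p) (deleteRowCol zero j′ M)
      sign : alt j′ (m * c) ≡ h j
      sign = trans (cong (λ y → alt j′ (m * alt r (alt (punchOut p) y)))
                         (det-cong (deleteRowCol-deleteRowCol M r s j p)))
                   (alt-nested-cofactor s j p r m _)

  strictlyIncreasing⇒injective : ∀ {k n} {σ : Fin k → Fin n} → StrictlyIncreasing σ → Injective _≡_ _≡_ σ
  strictlyIncreasing⇒injective σ↑ {i} {j} σi≡σj with <-cmp i j
  ... | tri< i<j _ _ = contradiction σi≡σj (<⇒≢ (σ↑ i j i<j))
  ... | tri≈ _ i≡j _ = i≡j
  ... | tri> _ _ j<i = contradiction (sym σi≡σj) (<⇒≢ (σ↑ j i j<i))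

  punchIn-strictlyIncreasing : ∀ {m} (a : Fin (suc m)) → StrictlyIncreasing (punchIn a)
  punchIn-strictlyIncreasing a i j i<j =
    ≤∧≢⇒< (punchIn-mono-≤ a i j (<⇒≤ i<j)) (<⇒≢ i<j ∘ punchIn-injective a i j)

  principalMinor-nonneg : ∀ {n} {M : Matrix n} → IsP₀ M →
                          ∀ {m} (σ : Fin m → Fin n) → StrictlyIncreasing σ → 0# ≤ det (principalSub M σ)
  principalMinor-nonneg P₀ {zero}  σ σ↑ = 0≤1
  principalMinor-nonneg P₀ {suc m} σ σ↑ = P₀ m σ σ↑

  IsP₀-cong : ∀ {n} {M M' : Matrix n} → (∀ i j → M' i j ≡ M i j) → IsP₀ M → IsP₀ M'
  IsP₀-cong M'≗M P₀ k σ σ↑ = subst (0# ≤_) (det-cong λ a b → sym (M'≗M (σ a) (σ b))) (P₀ k σ σ↑)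

  EntryIncrement-principalSub : ∀ {k n} {M M' : Matrix n} {t} {σ : Fin k → Fin n} {a} →
    StrictlyIncreasing σ → EntryIncrement M (σ a) (σ a) t M' →
    EntryIncrement (principalSub M σ) a a t (principalSub M' σ)
  EntryIncrement-principalSub σ↑ inc = record
    { other-rows = λ i j i≢a → other-rows _ _ (i≢a ∘ strictlyIncreasing⇒injective σ↑)
    ; same-row   = λ j j≢a → same-row _ (j≢a ∘ strictlyIncreasing⇒injective σ↑)
    ; entry      = entry
    }
    where open EntryIncrement inc

  IsP₀-diagonalIncrement : ∀ {n} {M M' : Matrix n} {r t} → 0# ≤ t → EntryIncrement M r r t M' → IsP₀ M → IsP₀ M'
  IsP₀-diagonalIncrement {M = M} {M'} {r} 0≤t inc P₀ k σ σ↑ with any? (λ a → σ a ≟ r)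
  ... | no r∉σ = subst (0# ≤_) (det-cong λ a b → sym (EntryIncrement.other-rows inc (σ a) (σ b) (r∉σ ∘ (a ,_))))
                       (P₀ k σ σ↑)
  ... | yes (a , refl) = subst (0# ≤_) (sym (det-increment (EntryIncrement-principalSub {M = M} {M'} σ↑ inc)))
    (+-nonneg (P₀ k σ σ↑) (*-nonneg 0≤t (subst (0# ≤_) (sym (alt-involutive a _)) minor-nonneg)))
    where
    minor-nonneg : 0# ≤ det (principalSub M (σ ∘ punchIn a))
    minor-nonneg = principalMinor-nonneg {M = M} P₀ (σ ∘ punchIn a)
                     λ i j i<j → σ↑ _ _ (punchIn-strictlyIncreasing a i j i<j)

  setEntry : ∀ {n} → Matrix n → Fin n → Fin n → R → Matrix n
  setEntry M r s x = updateAt M r (λ row → updateAt row s (const x))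

  setEntry-EntryIncrement : ∀ {n} (M : Matrix n) r s x → EntryIncrement M r s (x + - M r s) (setEntry M r s x)
  setEntry-EntryIncrement M r s x = record
    { other-rows = λ i j i≢r → cong-app (updateAt-minimal i r M i≢r) j
    ; same-row   = λ j j≢s → trans (cong-app (updateAt-updates r M) j) (updateAt-minimal j s (M r) j≢s)
    ; entry      = trans (cong-app (updateAt-updates r M) s)
                     (trans (updateAt-updates s (M r)) (sym (x+[y-x]≡y (M r s) x)))
    }

  IsP₀-diagonal-mono-on : ∀ {n} (L : List (Fin n)) {M M' : Matrix n} →
    (∀ i j → i ≢ j → M' i j ≡ M i j) → (∀ i → M i i ≤ M' i i) → (∀ i → i ∉ L → M' i i ≡ M i i) →
    IsP₀ M → IsP₀ M'
  IsP₀-diagonal-mono-on [] {M} {M'} off _ fixed = IsP₀-cong M'≗M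
    where
    M'≗M : ∀ i j → M' i j ≡ M i j
    M'≗M i j with i ≟ j
    ... | yes refl = fixed i λ ()
    ... | no i≢j   = off i j i≢j
  IsP₀-diagonal-mono-on (r ∷ L) {M} {M'} off diag fixed P₀ =
    IsP₀-diagonal-mono-on L off₁ diag₁ fixed₁ (IsP₀-diagonalIncrement (x≤y⇒0≤y-x (diag r)) inc₁ P₀)
    where
    M₁ = setEntry M r r (M' r r)
    inc₁ = setEntry-EntryIncrement M r r (M' r r)
    open EntryIncrement inc₁
    M₁-rr : M₁ r r ≡ M' r r
    M₁-rr = trans entry (x+[y-x]≡y (M r r) (M' r r))
    off₁ : ∀ i j → i ≢ j → M' i j ≡ M₁ i j
    off₁ i j i≢j with i ≟ r
    ... | yes refl = trans (off i j i≢j) (sym (other-columns i j (i≢j ∘ sym)))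
    ... | no i≢r   = trans (off i j i≢j) (sym (other-rows i j i≢r))
    diag₁ : ∀ i → M₁ i i ≤ M' i i
    diag₁ i with i ≟ r
    ... | yes refl = ≤-reflexive M₁-rr
    ... | no i≢r   = subst (_≤ M' i i) (sym (other-rows i i i≢r)) (diag i)
    fixed₁ : ∀ i → i ∉ L → M' i i ≡ M₁ i i
    fixed₁ i i∉L with i ≟ r
    ... | yes refl = sym M₁-rr
    ... | no i≢r   = trans (fixed i λ { (here i≡r) → i≢r i≡r ; (there i∈L) → i∉L i∈L }) (sym (other-rows i i i≢r))

  IsP₀-diagonal-mono : ∀ {n} {M M' : Matrix n} →
    (∀ i j → i ≢ j → M' i j ≡ M i j) → (∀ i → M i i ≤ M' i i) → IsP₀ M → IsP₀ M'
  IsP₀-diagonal-mono {n} off diag = IsP₀-diagonal-mono-on (allFin n) off diag λ i i∉ → contradiction (∈-allFin i) i∉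

  P₀⁺⇒P₀ : ∀ {n} {M : Matrix n} → IsP₀⁺ M → IsP₀ M
  P₀⁺⇒P₀ P₀⁺ k σ σ↑ = proj₁ (P₀⁺ k (injective⇒≤ (strictlyIncreasing⇒injective σ↑))) σ σ↑

  P₀⇒diagonal-nonneg : ∀ {n} {M : Matrix n} → IsP₀ M → ∀ i → 0# ≤ M i i
  P₀⇒diagonal-nonneg P₀ i = subst (0# ≤_) (trans (+-identityʳ _) (*-identityʳ _)) (P₀ 0 (const i) λ { zero zero () })

  fullySpecified? : ∀ {n} (A : PartialMatrix n) → Dec (∃[ M ] FullySpecified A M)
  fullySpecified? A = map′ (λ A≡just → (λ i j → proj₁ (A≡just i j)) , λ i j → proj₂ (A≡just i j))
                           (λ (M , A≡M) i j → M i j , A≡M i j)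
                           (all? λ i → all? λ j → specified? (A i j))
    where
    specified? : (x : Maybe R) → Dec (∃[ y ] x ≡ just y)
    specified? (just y) = yes (y , refl)
    specified? nothing  = no λ ()

  fullySpecified⇒isCompletion : ∀ {n} {A : PartialMatrix n} {M} → FullySpecified A M → IsCompletion A M
  fullySpecified⇒isCompletion A≡M i j x Aij≡x = just-injective (trans (sym (A≡M i j)) Aij≡x)

  fullySpecified⇒SSP₀₁ : ∀ {n} {A : PartialMatrix n} {M} → FullySpecified A M → IsPartialSSP₀₁ A →
                         IsSignSymmetric M × IsP₀₁ M
  fullySpecified⇒SSP₀₁ {M = M} A≡M (diagonal , minors , signs) =
      (λ i j i≢j → signs i j i≢j _ _ (A≡M i j) (A≡M j i))
    , (λ k σ σ↑ → minors k σ σ↑ (principalSub M σ) λ a b → A≡M (σ a) (σ b))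
    , (λ i → diagonal i _ (A≡M i i))

  partialSSP₀₁⇒partialSSP₀⁺ : ∀ {n} {A : PartialMatrix n} → ¬ (∃[ M ] FullySpecified A M) →
                              IsPartialSSP₀₁ A → IsPartialSSP₀⁺ A
  partialSSP₀₁⇒partialSSP₀⁺ partial (_ , minors , signs) =
    minors , signs , λ M A≡M → contradiction (M , A≡M) partial

  raiseUnspecifiedDiagonal : ∀ {n} → PartialMatrix n → Matrix n → Matrix n
  raiseUnspecifiedDiagonal A B i j with i ≟ j | A i j
  ... | yes _ | nothing = B i j + 1#
  ... | _     | _       = B i j

  module _ {n} (A : PartialMatrix n) (B : Matrix n) where

    raise-offDiagonal : ∀ i j → i ≢ j → raiseUnspecifiedDiagonal A B i j ≡ B i j
    raise-offDiagonal i j i≢j with i ≟ j | A i j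
    ... | yes i≡j | _      = contradiction i≡j i≢j
    ... | no _    | just _ = refl
    ... | no _    | nothing = refl

    raise-specified : ∀ {i j x} → A i j ≡ just x → raiseUnspecifiedDiagonal A B i j ≡ B i j
    raise-specified {i} {j} Aij≡x with i ≟ j | A i j
    ... | yes _ | just _ = refl
    ... | no _  | just _ = refl

    raise-diagonal : ∀ i → (∃[ x ] A i i ≡ just x × raiseUnspecifiedDiagonal A B i i ≡ B i i)
                           ⊎ raiseUnspecifiedDiagonal A B i i ≡ B i i + 1#
    raise-diagonal i with i ≟ i | A i i
    ... | yes _  | just x  = inj₁ (x , refl , refl)
    ... | yes _  | nothing = inj₂ refl
    ... | no i≢i | _       = contradiction refl i≢i

  ssP₀Completion⇒ssP₀₁Completion : ∀ {n} {A : PartialMatrix n} {B} → IsPartialSSP₀₁ A →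
    IsCompletion A B → IsSignSymmetric B → IsP₀ B →
    ∃[ B' ] (IsCompletion A B' × IsSignSymmetric B' × IsP₀₁ B')
  ssP₀Completion⇒ssP₀₁Completion {A = A} {B} (diagonal , _ , _) B-completes B-signs P₀ =
    B⁺ , completes , signs , IsP₀-diagonal-mono {M = B} (raise-offDiagonal A B) raised P₀ , positive
    where
    B⁺ = raiseUnspecifiedDiagonal A B
    completes : IsCompletion A B⁺
    completes i j x Aij≡x = trans (raise-specified A B Aij≡x) (B-completes i j x Aij≡x)
    signs : IsSignSymmetric B⁺
    signs i j i≢j rewrite raise-offDiagonal A B i j i≢j | raise-offDiagonal A B j i (i≢j ∘ sym) = B-signs i j i≢j
    raised : ∀ i → B i i ≤ B⁺ i i
    raised i with raise-diagonal A B i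
    ... | inj₁ (_ , _ , B⁺ii≡Bii) = ≤-reflexive (sym B⁺ii≡Bii)
    ... | inj₂ B⁺ii≡Bii+1        = subst (B i i ≤_) (sym B⁺ii≡Bii+1) (x≤x+t 0≤1)
    positive : ∀ i → 0# < B⁺ i i
    positive i with raise-diagonal A B i
    ... | inj₁ (x , Aii≡x , B⁺ii≡Bii) =
      subst (0# <_) (sym (trans B⁺ii≡Bii (B-completes i i x Aii≡x))) (diagonal i x Aii≡x)
    ... | inj₂ B⁺ii≡Bii+1 =
      subst (0# <_) (sym B⁺ii≡Bii+1) (0≤x⇒0<x+1 (P₀⇒diagonal-nonneg {M = B} P₀ i))

corollary4p5 : (ℝ : CompleteOrderedField) → (n : ℕ) → (D : Matrices.Digraph ℝ n) →
    Matrices.HasSSP₀⁺Completion ℝ D → Matrices.HasSSP₀₁Completion ℝ D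
corollary4p5 ℝ _ _ hasSSP₀⁺Completion A A-specifies-D A-SSP₀₁ = case fullySpecified? A of λ where
    (yes (M , A≡M)) → M , fullySpecified⇒isCompletion A≡M , fullySpecified⇒SSP₀₁ A≡M A-SSP₀₁
    (no partial) →
      let B , B-completes , B-signs , B-P₀⁺ =
            hasSSP₀⁺Completion A A-specifies-D (partialSSP₀₁⇒partialSSP₀⁺ partial A-SSP₀₁)
      in ssP₀Completion⇒ssP₀₁Completion A-SSP₀₁ B-completes B-signs (P₀⁺⇒P₀ {M = B} B-P₀⁺)
  where open SignSymmetricCompletion ℝ
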